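{- If the set of all Diophantine equations which have only finitely many rational solutions is recursively enumerable, then there exists an algorithm which decides whether or not a given Diophantine equation has a rational solution.
   Context: A Diophantine equation is an equation $D(x_1,\ldots,x_p)=0$ with $D \in \mathbb{Z}[x_1,\ldots,x_p]$. -}

module Defs where

open import Data.Nat using (ℕ)
open import Data.Bool using (Bool; true)
open import Data.Fin using (Fin)
open import Data.Integer using (ℤ)
open import Data.Rational using (ℚ; _+_; _*_; 0ℚ; _/_)
import Data.Rational as ℚ
open import Data.Vec using (Vec; lookup)
open import Data.List using (List)
open import Data.List.Membership.Propositional using (_∈_)
open import Data.Maybe using (Maybe; just)
open import Data.Product using (Σ; ∃; _×_; _,_; proj₁)
open import Relation.Binary.PropositionalEquality using (_≡_)
open import Relation.Nullary using (¬_)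
open import Function.Bundles using (_⇔_)

data Poly (p : ℕ) : Set where
  var  : Fin p → Poly p
  con  : ℤ → Poly p
  _⊕_  : Poly p → Poly p → Poly p
  _⊗_  : Poly p → Poly p → Poly p

eval : ∀ {p} → Poly p → Vec ℚ p → ℚ
eval (var i) x = lookup x i
eval (con c) x = c / 1
eval (a ⊕ b) x = eval a x + eval b x
eval (a ⊗ b) x = eval a x * eval b x

DiophantineEquation : Set
DiophantineEquation = Σ ℕ Poly

IsRationalSolution : (D : DiophantineEquation) → Vec ℚ (proj₁ D) → Set
IsRationalSolution (p , P) x = eval P x ≡ 0ℚ

HasRationalSolution : DiophantineEquation → Set
HasRationalSolution D = ∃ λ x → IsRationalSolution D x

HasFinitelyManyRationalSolutions : DiophantineEquation → Set
HasFinitelyManyRationalSolutions D =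
  Σ (List (Vec ℚ (proj₁ D))) λ L → ∀ x → IsRationalSolution D x → x ∈ L

-- A set of Diophantine equations is recursively enumerable: it is the range of
-- a (computable, i.e. Agda-definable) enumeration ℕ → Maybe equation.
RecursivelyEnumerable : (DiophantineEquation → Set) → Set
RecursivelyEnumerable S =
  Σ (ℕ → Maybe DiophantineEquation) λ e → ∀ D → S D ⇔ (∃ λ n → e n ≡ just D)

-- Markov's principle (realised by unbounded search), used to model the
-- classical termination argument for algorithms in constructive Agda.
MarkovPrinciple : Set
MarkovPrinciple =
  (f : ℕ → Bool) → ¬ ¬ (∃ λ n → f n ≡ true) → ∃ λ n → f n ≡ true

-- Adding a dummy variable t to D gives an equation D' whose rational solutions are
-- the pairs (t, x) with x a solution of D, so D' has finitely many rational solutions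
-- exactly when D has none. Hence, if the equations with finitely many solutions are
-- recursively enumerable, "D has no rational solution" is semi-decidable; "D has a
-- rational solution" always is, by enumerating ℚ^p. Running both searches in parallel
-- decides solvability, and Markov's principle is what makes the parallel search halt.
module Submission where

open import Defs
open import Data.Bool using (true)
open import Data.Bool.Properties using (T-≡)
open import Data.Empty using (⊥-elim)
open import Data.Fin using () renaming (suc to fsuc)
import Data.Fin.Properties as Fin
open import Data.Integer using (ℤ; +_; -[1+_]; _⊖_; ∣_∣)
import Data.Integer.Properties as ℤ
open import Data.List as List using (List; map)
open import Data.List.Extrema.Nat using (max; xs≤max)
open import Data.List.Membership.Propositional using (_∉_)
open import Data.List.Membership.Propositional.Properties using (∈-map⁺)
import Data.List.Relation.Unary.All as All
open import Data.Maybe using (just)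
import Data.Maybe.Properties as Maybe
open import Data.Nat using (ℕ; zero; suc; _+_; _≤_)
open import Data.Nat.Coprimality using (1-coprimeTo) renaming (sym to coprime-sym)
open import Data.Nat.Properties using (+-suc; +-identityʳ; <-irrefl)
import Data.Nat.Properties as ℕ
open import Data.Product using (Σ; ∃; _×_; _,_; map₂; uncurry)
open import Data.Product.Function.NonDependent.Propositional using (_×-↠_)
import Data.Product.Properties as Product
open import Data.Rational as ℚ using (ℚ; mkℚ; mkℚ+; ↥_; 0ℚ)
open import Data.Rational.Properties using (↥p/↧p≡p)
open import Data.Sum using (_⊎_; inj₁; inj₂)
open import Data.Vec using (Vec; []; _∷_; head)
open import Function using (_∘_)
open import Function.Bundles using (_↠_; mk↠ₛ; Surjection; _⇔_; mk⇔; Equivalence)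
open import Function.Construct.Composition using (_↠-∘_; _⇔-∘_)
open import Function.Construct.Identity using (↠-id)
open import Function.Construct.Symmetry using (⇔-sym)
open import Relation.Binary.Definitions using (DecidableEquality)
open import Relation.Binary.PropositionalEquality
open import Relation.Nullary using (Dec; yes; no; ¬_)
open import Relation.Nullary.Decidable using (isYes; map′; _×-dec_; _⊎-dec_; toWitness; fromWitness)
open import Relation.Unary using (Decidable)

Semidecidable : Set → Set₁
Semidecidable A = Σ (ℕ → Set) λ P → Decidable P × (A ⇔ ∃ P)

markov-search : MarkovPrinciple → {P : ℕ → Set} → Decidable P → ¬ ¬ ∃ P → ∃ P
markov-search mp {P} P? ¬¬∃P = map₂ witness (mp (isYes ∘ P?) ¬¬found)
  where
  witness : ∀ {n} → isYes (P? n) ≡ true → P n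
  witness = toWitness ∘ Equivalence.from T-≡
  ¬¬found : ¬ ¬ ∃ λ n → isYes (P? n) ≡ true
  ¬¬found ¬found = ¬¬∃P λ (n , p) → ¬found (n , Equivalence.to T-≡ (fromWitness p))

semidecidable-both⇒dec : MarkovPrinciple → {A : Set} →
                         Semidecidable A → Semidecidable (¬ A) → Dec A
semidecidable-both⇒dec mp {A} (P , P? , A⇔∃P) (Q , Q? , ¬A⇔∃Q) =
  decide (markov-search mp (λ n → P? n ⊎-dec Q? n) ¬¬∃P⊎Q)
  where
  ¬¬∃P⊎Q : ¬ ¬ ∃ λ n → P n ⊎ Q n
  ¬¬∃P⊎Q ¬∃ = ¬∃ (map₂ inj₂ (Equivalence.to ¬A⇔∃Q ¬a))
    where
    ¬a : ¬ A
    ¬a a = ¬∃ (map₂ inj₁ (Equivalence.to A⇔∃P a))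
  decide : (∃ λ n → P n ⊎ Q n) → Dec A
  decide (n , inj₁ p) = yes (Equivalence.from A⇔∃P (n , p))
  decide (n , inj₂ q) = no (Equivalence.from ¬A⇔∃Q (n , q))

next-on-antidiagonal : ℕ × ℕ → ℕ × ℕ
next-on-antidiagonal (zero  , b) = suc b , 0
next-on-antidiagonal (suc a , b) = a , suc b

unpair : ℕ → ℕ × ℕ
unpair zero    = 0 , 0
unpair (suc n) = next-on-antidiagonal (unpair n)

unpair-walk : ∀ j {n a b} → unpair n ≡ (j + a , b) → unpair (j + n) ≡ (a , j + b)
unpair-walk zero    eq = eq
unpair-walk (suc j) {a = a} {b} eq =
  cong next-on-antidiagonal (unpair-walk j (trans eq (cong (_, b) (sym (+-suc j a)))))

unpair-hits-axis : ∀ s → ∃ λ n → unpair n ≡ (s , 0)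
unpair-hits-axis zero = 0 , refl
unpair-hits-axis (suc s) with n , eq ← unpair-hits-axis s =
  suc (s + n) , (begin
    next-on-antidiagonal (unpair (s + n)) ≡⟨ cong next-on-antidiagonal (unpair-walk s eq′) ⟩
    suc (s + 0) , 0                        ≡⟨ cong (λ k → suc k , 0) (+-identityʳ s) ⟩
    suc s , 0                              ∎)
  where
  open ≡-Reasoning
  eq′ : unpair n ≡ (s + 0 , 0)
  eq′ = trans eq (cong (_, 0) (sym (+-identityʳ s)))

unpair-surjective : ∀ a b → ∃ λ n → unpair n ≡ (a , b)
unpair-surjective a b with n , eq ← unpair-hits-axis (b + a) =
  b + n , trans (unpair-walk b eq) (cong (a ,_) (+-identityʳ b))

ℕ↠ℕ×ℕ : ℕ ↠ (ℕ × ℕ)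
ℕ↠ℕ×ℕ = mk↠ₛ λ (a , b) → unpair-surjective a b

enumerate-× : ∀ {A B : Set} → ℕ ↠ A → ℕ ↠ B → ℕ ↠ (A × B)
enumerate-× eA eB = (eA ×-↠ eB) ↠-∘ ℕ↠ℕ×ℕ

ℕ×ℕ↠ℤ : (ℕ × ℕ) ↠ ℤ
ℕ×ℕ↠ℤ = mk↠ₛ {to = uncurry _⊖_} λ where
  (+ n)    → (n , 0) , refl
  -[1+ n ] → (0 , suc n) , refl

ℤ×ℕ↠ℚ : (ℤ × ℕ) ↠ ℚ
ℤ×ℕ↠ℚ = mk↠ₛ {to = λ (z , d) → z ℚ./ suc d} λ where
  q@(mkℚ n d _) → (n , d) , ↥p/↧p≡p q

ℕ↠ℤ : ℕ ↠ ℤ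
ℕ↠ℤ = ℕ×ℕ↠ℤ ↠-∘ ℕ↠ℕ×ℕ

ℕ↠ℚ : ℕ ↠ ℚ
ℕ↠ℚ = ℤ×ℕ↠ℚ ↠-∘ enumerate-× ℕ↠ℤ (↠-id ℕ)

×↠Vec-suc : ∀ {A : Set} {p} → (A × Vec A p) ↠ Vec A (suc p)
×↠Vec-suc = mk↠ₛ {to = uncurry _∷_} λ where
  (x ∷ xs) → (x , xs) , refl

enumerate-Vec : ∀ {A : Set} → ℕ ↠ A → ∀ p → ℕ ↠ Vec A p
enumerate-Vec eA zero    = mk↠ₛ {to = λ _ → []} λ where
  [] → 0 , refl
enumerate-Vec eA (suc p) = ×↠Vec-suc ↠-∘ enumerate-× eA (enumerate-Vec eA p)

_≟ᴾ_ : ∀ {p} → DecidableEquality (Poly p)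
var i   ≟ᴾ var j   = map′ (cong var) (λ { refl → refl }) (i Fin.≟ j)
con a   ≟ᴾ con b   = map′ (cong con) (λ { refl → refl }) (a ℤ.≟ b)
(a ⊕ b) ≟ᴾ (c ⊕ d) = map′ (uncurry (cong₂ _⊕_)) (λ { refl → refl , refl }) (a ≟ᴾ c ×-dec b ≟ᴾ d)
(a ⊗ b) ≟ᴾ (c ⊗ d) = map′ (uncurry (cong₂ _⊗_)) (λ { refl → refl , refl }) (a ≟ᴾ c ×-dec b ≟ᴾ d)
var _   ≟ᴾ con _   = no λ ()
var _   ≟ᴾ (_ ⊕ _) = no λ ()
var _   ≟ᴾ (_ ⊗ _) = no λ ()
con _   ≟ᴾ var _   = no λ ()
con _   ≟ᴾ (_ ⊕ _) = no λ ()
con _   ≟ᴾ (_ ⊗ _) = no λ ()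
(_ ⊕ _) ≟ᴾ var _   = no λ ()
(_ ⊕ _) ≟ᴾ con _   = no λ ()
(_ ⊕ _) ≟ᴾ (_ ⊗ _) = no λ ()
(_ ⊗ _) ≟ᴾ var _   = no λ ()
(_ ⊗ _) ≟ᴾ con _   = no λ ()
(_ ⊗ _) ≟ᴾ (_ ⊕ _) = no λ ()

_≟ᴰ_ : DecidableEquality DiophantineEquation
_≟ᴰ_ = Product.≡-dec ℕ._≟_ _≟ᴾ_

weaken : ∀ {p} → Poly p → Poly (suc p)
weaken (var i) = var (fsuc i)
weaken (con c) = con c
weaken (a ⊕ b) = weaken a ⊕ weaken b
weaken (a ⊗ b) = weaken a ⊗ weaken b

eval-weaken : ∀ {p} (P : Poly p) t x → eval (weaken P) (t ∷ x) ≡ eval P x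
eval-weaken (var i) t x = refl
eval-weaken (con c) t x = refl
eval-weaken (a ⊕ b) t x = cong₂ ℚ._+_ (eval-weaken a t x) (eval-weaken b t x)
eval-weaken (a ⊗ b) t x = cong₂ ℚ._*_ (eval-weaken a t x) (eval-weaken b t x)

addDummyVariable : DiophantineEquation → DiophantineEquation
addDummyVariable (p , P) = suc p , weaken P

solution-addDummyVariable⇔ : ∀ D t x →
  IsRationalSolution (addDummyVariable D) (t ∷ x) ⇔ IsRationalSolution D x
solution-addDummyVariable⇔ (p , P) t x =
  mk⇔ (trans (sym (eval-weaken P t x))) (trans (eval-weaken P t x))

finite-list-misses-retract : ∀ {A : Set} (ι : ℕ → A) (π : A → ℕ) → (∀ n → π (ι n) ≡ n) →
                             (L : List A) → ∃ λ n → ι n ∉ L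
finite-list-misses-retract ι π πι≗id L = m , ιm∉L
  where
  m : ℕ
  m = suc (max 0 (map π L))
  ιm∉L : ι m ∉ L
  ιm∉L ιm∈L = <-irrefl refl (subst (_≤ max 0 (map π L)) (πι≗id m) πιm≤max)
    where
    πιm≤max : π (ι m) ≤ max 0 (map π L)
    πιm≤max = All.lookup (xs≤max 0 (map π L)) (∈-map⁺ π ιm∈L)

fromℕ : ℕ → ℚ
fromℕ n = mkℚ+ n 1 (coprime-sym (1-coprimeTo n))

finitelyMany-addDummyVariable⇔noSolution : ∀ D →
  HasFinitelyManyRationalSolutions (addDummyVariable D) ⇔ (¬ HasRationalSolution D)
finitelyMany-addDummyVariable⇔noSolution D = mk⇔ finite⇒none none⇒finite
  where
  finite⇒none : HasFinitelyManyRationalSolutions (addDummyVariable D) → ¬ HasRationalSolution D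
  finite⇒none (L , complete) (x , sol)
    with t , t∷x∉L ← finite-list-misses-retract (λ t → fromℕ t ∷ x) (∣_∣ ∘ ↥_ ∘ head)
                                                  (λ _ → refl) L =
    t∷x∉L (complete (fromℕ t ∷ x)
                    (Equivalence.from (solution-addDummyVariable⇔ D (fromℕ t) x) sol))
  none⇒finite : ¬ HasRationalSolution D → HasFinitelyManyRationalSolutions (addDummyVariable D)
  none⇒finite ¬sol = List.[] , λ where
    (t ∷ x) sol → ⊥-elim (¬sol (x , Equivalence.to (solution-addDummyVariable⇔ D t x) sol))

hasSolution-semidecidable : ∀ D → Semidecidable (HasRationalSolution D)
hasSolution-semidecidable D@(p , P) =
  IsRationalSolution D ∘ enum , (λ n → eval P (enum n) ℚ.≟ 0ℚ) , mk⇔ search found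
  where
  open Surjection (enumerate-Vec ℕ↠ℚ p) renaming (to to enum)
  search : HasRationalSolution D → ∃ (IsRationalSolution D ∘ enum)
  search (x , sol) with n , enum-n≡x ← strictlySurjective x =
    n , subst (IsRationalSolution D) (sym enum-n≡x) sol
  found : ∃ (IsRationalSolution D ∘ enum) → HasRationalSolution D
  found (n , sol) = enum n , sol

noSolution-semidecidable : RecursivelyEnumerable HasFinitelyManyRationalSolutions →
                           ∀ D → Semidecidable (¬ HasRationalSolution D)
noSolution-semidecidable (e , enumerates) D =
  (λ n → e n ≡ just D′) , (λ n → Maybe.≡-dec _≟ᴰ_ (e n) (just D′)) ,
  enumerates D′ ⇔-∘ ⇔-sym (finitelyMany-addDummyVariable⇔noSolution D)
  where
  D′ : DiophantineEquation
  D′ = addDummyVariable D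

theorem10 : MarkovPrinciple
    → RecursivelyEnumerable HasFinitelyManyRationalSolutions
    → (D : DiophantineEquation) → Dec (HasRationalSolution D)
theorem10 mp re D =
  semidecidable-both⇒dec mp (hasSolution-semidecidable D) (noSolution-semidecidable re D)
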